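{- For all integers $q,n$ with $0\le q<n$, \[\sum_{m=0}^n \frac{c_{2n-2m,n}}{(2m)!}\, \Omega_{q,m} = 0.\]
   Context: For integers $k\ge0$, $r\ge0$, $c_{k,r}$ denotes the coefficient of $x^k$ in the Taylor expansion at $0$ of $\left(\frac{x}{\sinh x}\right)^{2r+1}$. For integers $q\ge0$, $p\ge0$, $\Omega_{q,p} := \frac{1}{4^{q}}\sum_{k=0}^{q} \binom{2q+1}{k}(2q+1-2k)^{2p}$. -}

module Defs where

open import Data.Bool.Base using (Bool; true; false; not; if_then_else_)
open import Data.Nat.Base as ℕ using (ℕ; zero; suc; _∸_; _!; _^_)
open import Data.Nat.Properties using (_!≢0; m^n≢0)
open import Data.Nat.Combinatorics using (_C_)
open import Data.Integer.Base using (+_)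
open import Data.List.Base using (List; []; _∷_)
open import Data.Rational.Base using (ℚ; 0ℚ; 1ℚ; _+_; _*_; -_; _/_)

-- Formal power series over ℚ, represented by their coefficient functions.
Series : Set
Series = ℕ → ℚ

sumTo : ℕ → (ℕ → ℚ) → ℚ
sumTo zero    f = f 0
sumTo (suc n) f = sumTo n f + f (suc n)

isEven : ℕ → Bool
isEven zero    = true
isEven (suc n) = not (isEven n)

invFact : ℕ → ℚ
invFact k = (+ 1 / (k !)) {{k !≢0}}

-- Taylor coefficients of sinh x / x = Σ_j x^{2j} / (2j+1)!
sinhOverX : Series
sinhOverX k = if isEven k then invFact (suc k) else 0ℚ

mulS : Series → Series → Series
mulS f g n = sumTo n (λ i → f i * g (n ∸ i))

oneS : Series
oneS zero    = 1ℚ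
oneS (suc _) = 0ℚ

powS : Series → ℕ → Series
powS f zero    = oneS
powS f (suc r) = mulS f (powS f r)

-- Reciprocal of a series a with a 0 = 1:  b 0 = 1,
-- b n = - Σ_{i=1}^{n} a i * b (n - i).
-- invList a n = [b n, b (n-1), ..., b 0].
private
  dot : Series → ℕ → List ℚ → ℚ
  dot a j []       = 0ℚ
  dot a j (b ∷ bs) = a (suc j) * b + dot a (suc j) bs

invList : Series → ℕ → List ℚ
invList a zero    = 1ℚ ∷ []
invList a (suc n) = (- dot a 0 (invList a n)) ∷ invList a n

headQ : List ℚ → ℚ
headQ []      = 0ℚ
headQ (b ∷ _) = b

invS : Series → Series
invS a n = headQ (invList a n)

xOverSinhX : Series
xOverSinhX = invS sinhOverX

c : ℕ → ℕ → ℚ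
c k r = powS xOverSinhX (suc (2 ℕ.* r)) k

Ω : ℕ → ℕ → ℚ
Ω q p = (+ 1 / (4 ^ q)) {{m^n≢0 4 q}}
        * sumTo q (λ k → (+ (((suc (2 ℕ.* q)) C k) ℕ.* ((suc (2 ℕ.* q) ∸ 2 ℕ.* k) ^ (2 ℕ.* p)))) / 1)

-- With U = (x / sinh x)^(2n+1), the sum is the coefficient of x^(2n) in cosh^(2q+1) · U, that is, the residue
-- at 0 of cosh^(2q+1) / sinh^(2n+1). Expanding (e^x + e^-x)^(2q+1) binomially and pairing the terms k and 2q+1-k
-- shows that the coefficient of x^(2m) in cosh^(2q+1) is Ω_{q,m} / (2m)! and that its odd coefficients vanish.
-- For q = 0 the residue is zero because cosh / sinh^(2n+1) is the derivative of -sinh^(-2n) / (2n); for larger q,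
-- cosh² = 1 + sinh² writes the residue for (q+1, n) as the sum of those for (q, n) and (q, n-1).
-- Everything is computed with formal power series over ℚ, derivatives entering through θ = x d/dx.

module Submission where

open import Algebra.Bundles using (CommutativeRing; CommutativeSemiring)
open import Algebra.Structures using (IsCommutativeSemiring)
import Algebra.Solver.Ring.NaturalCoefficients.Default as NaturalCoefficients
open import Data.Bool.Base using (true; false; if_then_else_; not)
open import Data.Fin.Base using (toℕ)
import Data.Integer.Base as ℤ
import Data.Integer.Properties as ℤₚ
open import Data.List.Base using (List)
open import Data.Nat.Base as ℕ using (ℕ; zero; suc; _∸_; _≤_; _<_; z≤n; s≤s; _!; NonZero)
open import Data.Nat.Combinatorics using (_C_; nCk≡nC[n∸k])
import Data.Nat.Properties as ℕₚ
open import Data.Product.Base using (_,_)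
open import Data.Rational.Base using (ℚ; 0ℚ; 1ℚ; _+_; _*_; -_; _/_; fromℚᵘ)
import Data.Rational.Properties as ℚₚ
open import Data.Rational.Solver using (module +-*-Solver)
import Data.Rational.Unnormalised.Base as ℚᵘ
import Data.Rational.Unnormalised.Properties as ℚᵘₚ
open import Level using (0ℓ)
open import Relation.Binary.Bundles using (Setoid)
open import Relation.Binary.PropositionalEquality
import Relation.Binary.Reasoning.Setoid as ≈-Reasoning
open import Relation.Binary.Structures using (IsEquivalence)

open import Defs

open import Algebra.Properties.CommutativeSemiring.Exp (CommutativeRing.commutativeSemiring ℚₚ.+-*-commutativeRing)
  using (_^_)
open import Algebra.Properties.CommutativeSemigroup (CommutativeRing.+-commutativeSemigroup ℚₚ.+-*-commutativeRing)
  using () renaming (interchange to +-interchange)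
open import Algebra.Properties.CommutativeSemigroup (CommutativeRing.*-commutativeSemigroup ℚₚ.+-*-commutativeRing)
  using () renaming (x∙yz≈y∙xz to *-x∙yz≈y∙xz)

toℚ : ℕ → ℚ
toℚ n = ℤ.+ n / 1

fromℚᵘ-homo-+ : ∀ p q → fromℚᵘ (p ℚᵘ.+ q) ≡ fromℚᵘ p + fromℚᵘ q
fromℚᵘ-homo-+ p q = ℚₚ.toℚᵘ-injective (ℚᵘₚ.≃-trans (ℚₚ.toℚᵘ-fromℚᵘ (p ℚᵘ.+ q))
  (ℚᵘₚ.≃-sym (ℚᵘₚ.≃-trans (ℚₚ.toℚᵘ-homo-+ (fromℚᵘ p) (fromℚᵘ q))
                          (ℚᵘₚ.+-cong (ℚₚ.toℚᵘ-fromℚᵘ p) (ℚₚ.toℚᵘ-fromℚᵘ q)))))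

fromℚᵘ-homo-* : ∀ p q → fromℚᵘ (p ℚᵘ.* q) ≡ fromℚᵘ p * fromℚᵘ q
fromℚᵘ-homo-* p q = ℚₚ.toℚᵘ-injective (ℚᵘₚ.≃-trans (ℚₚ.toℚᵘ-fromℚᵘ (p ℚᵘ.* q))
  (ℚᵘₚ.≃-sym (ℚᵘₚ.≃-trans (ℚₚ.toℚᵘ-homo-* (fromℚᵘ p) (fromℚᵘ q))
                          (ℚᵘₚ.*-cong (ℚₚ.toℚᵘ-fromℚᵘ p) (ℚₚ.toℚᵘ-fromℚᵘ q)))))

ℕ→ℚᵘ : ℕ → ℚᵘ.ℚᵘ
ℕ→ℚᵘ n = ℚᵘ.mkℚᵘ (ℤ.+ n) 0

toℚ-homo-+ : ∀ m n → toℚ (m ℕ.+ n) ≡ toℚ m + toℚ n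
toℚ-homo-+ m n = trans (ℚₚ.fromℚᵘ-cong {ℕ→ℚᵘ (m ℕ.+ n)} {ℕ→ℚᵘ m ℚᵘ.+ ℕ→ℚᵘ n} (ℚᵘ.*≡* eq))
                       (fromℚᵘ-homo-+ (ℕ→ℚᵘ m) (ℕ→ℚᵘ n))
  where
  eq : ℤ.+ (m ℕ.+ n) ℤ.* ℤ.+ 1 ≡ (ℤ.+ m ℤ.* ℤ.+ 1 ℤ.+ ℤ.+ n ℤ.* ℤ.+ 1) ℤ.* ℤ.+ 1
  eq rewrite ℤₚ.*-identityʳ (ℤ.+ m) | ℤₚ.*-identityʳ (ℤ.+ n) | ℤₚ.*-identityʳ (ℤ.+ m ℤ.+ ℤ.+ n) = ℤₚ.pos-+ m n

toℚ-suc-* : ∀ n x → toℚ (suc n) * x ≡ x + toℚ n * x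
toℚ-suc-* n x = trans (cong (_* x) (toℚ-homo-+ 1 n))
                      (trans (ℚₚ.*-distribʳ-+ x 1ℚ (toℚ n)) (cong (_+ toℚ n * x) (ℚₚ.*-identityˡ x)))

toℚ-homo-* : ∀ m n → toℚ (m ℕ.* n) ≡ toℚ m * toℚ n
toℚ-homo-* m n = trans (ℚₚ.fromℚᵘ-cong {ℕ→ℚᵘ (m ℕ.* n)} {ℕ→ℚᵘ m ℚᵘ.* ℕ→ℚᵘ n} (ℚᵘ.*≡* eq))
                       (fromℚᵘ-homo-* (ℕ→ℚᵘ m) (ℕ→ℚᵘ n))
  where
  eq : ℤ.+ (m ℕ.* n) ℤ.* ℤ.+ 1 ≡ (ℤ.+ m ℤ.* ℤ.+ n) ℤ.* ℤ.+ 1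
  eq rewrite ℤₚ.*-identityʳ (ℤ.+ (m ℕ.* n)) | ℤₚ.*-identityʳ (ℤ.+ m ℤ.* ℤ.+ n) = ℤₚ.pos-* m n

toℚ-homo-^ : ∀ m n → toℚ (m ℕ.^ n) ≡ toℚ m ^ n
toℚ-homo-^ m zero    = refl
toℚ-homo-^ m (suc n) = trans (toℚ-homo-* m (m ℕ.^ n)) (cong (toℚ m *_) (toℚ-homo-^ m n))

1/-homo-* : ∀ m n .{{_ : NonZero m}} .{{_ : NonZero n}} →
            (ℤ.+ 1 / (m ℕ.* n)) {{ℕₚ.m*n≢0 m n}} ≡ (ℤ.+ 1 / m) * (ℤ.+ 1 / n)
1/-homo-* (suc m) (suc n) = fromℚᵘ-homo-* (ℚᵘ.mkℚᵘ (ℤ.+ 1) m) (ℚᵘ.mkℚᵘ (ℤ.+ 1) n)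

1/-*-toℚ : ∀ m .{{_ : NonZero m}} → (ℤ.+ 1 / m) * toℚ m ≡ 1ℚ
1/-*-toℚ (suc m) = trans (sym (fromℚᵘ-homo-* (ℚᵘ.mkℚᵘ (ℤ.+ 1) m) (ℕ→ℚᵘ (suc m))))
                         (ℚₚ.fromℚᵘ-cong {ℚᵘ.mkℚᵘ (ℤ.+ 1) m ℚᵘ.* ℕ→ℚᵘ (suc m)} {ℕ→ℚᵘ 1} (ℚᵘ.*≡* eq))
  where
  eq : (ℤ.+ 1 ℤ.* ℤ.+ suc m) ℤ.* ℤ.+ 1 ≡ ℤ.+ 1 ℤ.* (ℤ.+ suc m ℤ.* ℤ.+ 1)
  eq = trans (ℤₚ.*-comm (ℤ.+ 1 ℤ.* ℤ.+ suc m) (ℤ.+ 1)) (cong (ℤ.+ 1 ℤ.*_) (ℤₚ.*-comm (ℤ.+ 1) (ℤ.+ suc m)))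

1/-*-toℚ-* : ∀ m .{{_ : NonZero m}} x → (ℤ.+ 1 / m) * (toℚ m * x) ≡ x
1/-*-toℚ-* m x = begin
  (ℤ.+ 1 / m) * (toℚ m * x)    ≡⟨ ℚₚ.*-assoc (ℤ.+ 1 / m) (toℚ m) x ⟨
  ((ℤ.+ 1 / m) * toℚ m) * x    ≡⟨ cong (_* x) (1/-*-toℚ m) ⟩
  1ℚ * x                       ≡⟨ ℚₚ.*-identityˡ x ⟩
  x                            ∎
  where open ≡-Reasoning

toℚ-*-cancelˡ : ∀ m .{{_ : NonZero m}} {x y} → toℚ m * x ≡ toℚ m * y → x ≡ y
toℚ-*-cancelˡ m {x} {y} eq = trans (sym (1/-*-toℚ-* m x)) (trans (cong ((ℤ.+ 1 / m) *_) eq) (1/-*-toℚ-* m y))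

toℚ-suc-*-invFact-suc : ∀ j → toℚ (suc j) * invFact (suc j) ≡ invFact j
toℚ-suc-*-invFact-suc j = begin
  toℚ (suc j) * invFact (suc j)                  ≡⟨ cong (toℚ (suc j) *_) (1/-homo-* (suc j) (j !) {{_}} {{j ℕₚ.!≢0}}) ⟩
  toℚ (suc j) * ((ℤ.+ 1 / suc j) * invFact j)    ≡⟨ *-x∙yz≈y∙xz (toℚ (suc j)) (ℤ.+ 1 / suc j) (invFact j) ⟩
  (ℤ.+ 1 / suc j) * (toℚ (suc j) * invFact j)    ≡⟨ 1/-*-toℚ-* (suc j) (invFact j) ⟩
  invFact j                                      ∎
  where open ≡-Reasoning

-- Finite sums

sumTo-cong : ∀ n {f g : ℕ → ℚ} → (∀ i → i ≤ n → f i ≡ g i) → sumTo n f ≡ sumTo n g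
sumTo-cong zero    eq = eq 0 z≤n
sumTo-cong (suc n) eq = cong₂ _+_ (sumTo-cong n (λ i i≤n → eq i (ℕₚ.m≤n⇒m≤1+n i≤n))) (eq (suc n) ℕₚ.≤-refl)

sumTo-zero : ∀ n {f : ℕ → ℚ} → (∀ i → i ≤ n → f i ≡ 0ℚ) → sumTo n f ≡ 0ℚ
sumTo-zero zero    eq = eq 0 z≤n
sumTo-zero (suc n) eq = cong₂ _+_ (sumTo-zero n (λ i i≤n → eq i (ℕₚ.m≤n⇒m≤1+n i≤n))) (eq (suc n) ℕₚ.≤-refl)

sumTo-distrib-+ : ∀ n (f g : ℕ → ℚ) → sumTo n (λ i → f i + g i) ≡ sumTo n f + sumTo n g
sumTo-distrib-+ zero    f g = refl
sumTo-distrib-+ (suc n) f g = trans (cong (_+ (f (suc n) + g (suc n))) (sumTo-distrib-+ n f g))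
                                   (+-interchange (sumTo n f) (sumTo n g) (f (suc n)) (g (suc n)))

*-distribˡ-sumTo : ∀ n a (f : ℕ → ℚ) → a * sumTo n f ≡ sumTo n (λ i → a * f i)
*-distribˡ-sumTo zero    a f = refl
*-distribˡ-sumTo (suc n) a f = trans (ℚₚ.*-distribˡ-+ a (sumTo n f) (f (suc n)))
                                     (cong (_+ a * f (suc n)) (*-distribˡ-sumTo n a f))

*-distribʳ-sumTo : ∀ n a (f : ℕ → ℚ) → sumTo n f * a ≡ sumTo n (λ i → f i * a)
*-distribʳ-sumTo n a f = trans (ℚₚ.*-comm (sumTo n f) a)
  (trans (*-distribˡ-sumTo n a f) (sumTo-cong n (λ i _ → ℚₚ.*-comm a (f i))))

sumTo-suc : ∀ n (f : ℕ → ℚ) → sumTo (suc n) f ≡ f 0 + sumTo n (λ i → f (suc i))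
sumTo-suc zero    f = refl
sumTo-suc (suc n) f = trans (cong (_+ f (suc (suc n))) (sumTo-suc n f))
                            (ℚₚ.+-assoc (f 0) (sumTo n (λ i → f (suc i))) (f (suc (suc n))))

sumTo-reverse : ∀ n (f : ℕ → ℚ) → sumTo n f ≡ sumTo n (λ i → f (n ∸ i))
sumTo-reverse zero    f = refl
sumTo-reverse (suc n) f = sym (begin
  sumTo (suc n) (λ i → f (suc n ∸ i))       ≡⟨ sumTo-suc n (λ i → f (suc n ∸ i)) ⟩
  f (suc n) + sumTo n (λ i → f (n ∸ i))     ≡⟨ cong (f (suc n) +_) (sumTo-reverse n f) ⟨
  f (suc n) + sumTo n f                     ≡⟨ ℚₚ.+-comm (f (suc n)) (sumTo n f) ⟩
  sumTo (suc n) f                           ∎)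
  where open ≡-Reasoning

sumTo-split : ∀ a b (f : ℕ → ℚ) → sumTo (a ℕ.+ suc b) f ≡ sumTo a f + sumTo b (λ i → f (suc (a ℕ.+ i)))
sumTo-split a zero    f rewrite ℕₚ.+-comm a 1 | ℕₚ.+-identityʳ a = refl
sumTo-split a (suc b) f rewrite ℕₚ.+-suc a (suc b) =
  trans (cong (_+ f (suc (a ℕ.+ suc b))) (sumTo-split a b f))
        (ℚₚ.+-assoc (sumTo a f) (sumTo b (λ i → f (suc (a ℕ.+ i)))) (f (suc (a ℕ.+ suc b))))

2*m≡m+m : ∀ q → 2 ℕ.* q ≡ q ℕ.+ q
2*m≡m+m q = cong (q ℕ.+_) (ℕₚ.+-identityʳ q)

sumTo-mirror-pairs : ∀ q (f : ℕ → ℚ) → sumTo (suc (2 ℕ.* q)) f ≡ sumTo q (λ k → f k + f (suc (2 ℕ.* q) ∸ k))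
sumTo-mirror-pairs q f = begin
  sumTo (suc (2 ℕ.* q)) f
    ≡⟨ cong (λ n → sumTo n f) N≡q+[1+q] ⟩
  sumTo (q ℕ.+ suc q) f
    ≡⟨ sumTo-split q q f ⟩
  sumTo q f + sumTo q (λ i → f (suc (q ℕ.+ i)))
    ≡⟨ cong (sumTo q f +_) (sumTo-reverse q _) ⟩
  sumTo q f + sumTo q (λ i → f (suc (q ℕ.+ (q ∸ i))))
    ≡⟨ cong (sumTo q f +_) (sumTo-cong q (λ i i≤q → cong f (mirror i i≤q))) ⟩
  sumTo q f + sumTo q (λ i → f (suc (2 ℕ.* q) ∸ i))
    ≡⟨ sumTo-distrib-+ q f _ ⟨
  sumTo q (λ k → f k + f (suc (2 ℕ.* q) ∸ k))
    ∎
  where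
  open ≡-Reasoning
  N≡q+[1+q] : suc (2 ℕ.* q) ≡ q ℕ.+ suc q
  N≡q+[1+q] = trans (cong suc (2*m≡m+m q)) (sym (ℕₚ.+-suc q q))
  mirror : ∀ i → i ≤ q → suc (q ℕ.+ (q ∸ i)) ≡ suc (2 ℕ.* q) ∸ i
  mirror i i≤q = sym (trans (cong (λ n → suc n ∸ i) (2*m≡m+m q)) (ℕₚ.+-∸-assoc (suc q) i≤q))

sumTo-even-indices : ∀ n (f : ℕ → ℚ) → (∀ m → f (suc (2 ℕ.* m)) ≡ 0ℚ) →
                     sumTo (2 ℕ.* n) f ≡ sumTo n (λ m → f (2 ℕ.* m))
sumTo-even-indices zero    f odd≡0 = refl
sumTo-even-indices (suc n) f odd≡0 = begin
  sumTo (2 ℕ.* suc n) f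
    ≡⟨ cong (λ k → sumTo k f) (ℕₚ.*-suc 2 n) ⟩
  (sumTo (2 ℕ.* n) f + f (suc (2 ℕ.* n))) + f (suc (suc (2 ℕ.* n)))
    ≡⟨ cong₂ (λ u v → (u + v) + f (suc (suc (2 ℕ.* n)))) (sumTo-even-indices n f odd≡0) (odd≡0 n) ⟩
  (sumTo n (λ m → f (2 ℕ.* m)) + 0ℚ) + f (suc (suc (2 ℕ.* n)))
    ≡⟨ cong₂ _+_ (ℚₚ.+-identityʳ (sumTo n (λ m → f (2 ℕ.* m)))) (cong f (sym (ℕₚ.*-suc 2 n))) ⟩
  sumTo n (λ m → f (2 ℕ.* m)) + f (2 ℕ.* suc n)
    ∎
  where open ≡-Reasoning

sumTo-triangle : ∀ n (F : ℕ → ℕ → ℚ) →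
  sumTo n (λ i → sumTo i (λ j → F j i)) ≡ sumTo n (λ j → sumTo (n ∸ j) (λ l → F j (j ℕ.+ l)))
sumTo-triangle zero    F = refl
sumTo-triangle (suc n) F = begin
  sumTo n (λ i → sumTo i (λ j → F j i)) + sumTo (suc n) (λ j → F j (suc n))
    ≡⟨ cong (_+ sumTo (suc n) (λ j → F j (suc n))) (sumTo-triangle n F) ⟩
  R n + (sumTo n (λ j → F j (suc n)) + F (suc n) (suc n))
    ≡⟨ ℚₚ.+-assoc (R n) _ _ ⟨
  (R n + sumTo n (λ j → F j (suc n))) + F (suc n) (suc n)
    ≡⟨ cong (_+ F (suc n) (suc n)) (sumTo-distrib-+ n _ _) ⟨
  sumTo n (λ j → sumTo (n ∸ j) (λ l → F j (j ℕ.+ l)) + F j (suc n)) + F (suc n) (suc n)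
    ≡⟨ cong₂ _+_ (sumTo-cong n extend-row) (cong (F (suc n)) (sym (ℕₚ.+-identityʳ (suc n)))) ⟩
  sumTo n (λ j → sumTo (suc n ∸ j) (λ l → F j (j ℕ.+ l))) + sumTo 0 (λ l → F (suc n) (suc n ℕ.+ l))
    ≡⟨ cong (λ k → sumTo n (λ j → sumTo (suc n ∸ j) (λ l → F j (j ℕ.+ l))) + sumTo k (λ l → F (suc n) (suc n ℕ.+ l)))
            (sym (ℕₚ.n∸n≡0 n)) ⟩
  sumTo (suc n) (λ j → sumTo (suc n ∸ j) (λ l → F j (j ℕ.+ l)))
    ∎
  where
  open ≡-Reasoning
  R : ℕ → ℚ
  R m = sumTo m (λ j → sumTo (m ∸ j) (λ l → F j (j ℕ.+ l)))
  extend-row : ∀ j → j ≤ n →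
    sumTo (n ∸ j) (λ l → F j (j ℕ.+ l)) + F j (suc n) ≡ sumTo (suc n ∸ j) (λ l → F j (j ℕ.+ l))
  extend-row j j≤n rewrite ℕₚ.+-∸-assoc 1 j≤n =
    cong (λ k → sumTo (n ∸ j) (λ l → F j (j ℕ.+ l)) + F j k)
         (sym (trans (ℕₚ.+-suc j (n ∸ j)) (cong suc (ℕₚ.m+[n∸m]≡n j≤n))))

-- The semiring of formal power series

infix  4 _≈_
infixl 6 _⊕_
infixl 7 _⊛_
infixr 8 _•_ X⊛_

_≈_ : Series → Series → Set
f ≈ g = ∀ n → f n ≡ g n

zeroS : Series
zeroS _ = 0ℚ

_⊕_ : Series → Series → Series
(f ⊕ g) n = f n + g n

_⊛_ : Series → Series → Series
_⊛_ = mulS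

_•_ : ℚ → Series → Series
(a • f) n = a * f n

X⊛_ : Series → Series
(X⊛ f) zero    = 0ℚ
(X⊛ f) (suc n) = f n

≈-isEquivalence : IsEquivalence _≈_
≈-isEquivalence = record
  { refl  = λ _ → refl
  ; sym   = λ f≈g n → sym (f≈g n)
  ; trans = λ f≈g g≈h n → trans (f≈g n) (g≈h n)
  }

≈-setoid : Setoid 0ℓ 0ℓ
≈-setoid = record { isEquivalence = ≈-isEquivalence }

open IsEquivalence ≈-isEquivalence using () renaming (refl to ≈-refl; sym to ≈-sym; trans to ≈-trans)

⊕-cong : ∀ {f f′ g g′} → f ≈ f′ → g ≈ g′ → f ⊕ g ≈ f′ ⊕ g′
⊕-cong f≈f′ g≈g′ n = cong₂ _+_ (f≈f′ n) (g≈g′ n)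

⊛-cong : ∀ {f f′ g g′} → f ≈ f′ → g ≈ g′ → f ⊛ g ≈ f′ ⊛ g′
⊛-cong f≈f′ g≈g′ n = sumTo-cong n (λ i _ → cong₂ _*_ (f≈f′ i) (g≈g′ (n ∸ i)))

⊛-congˡ : ∀ f {g h} → g ≈ h → f ⊛ g ≈ f ⊛ h
⊛-congˡ f = ⊛-cong {f} ≈-refl

⊛-congʳ : ∀ h {f g} → f ≈ g → f ⊛ h ≈ g ⊛ h
⊛-congʳ h f≈g = ⊛-cong f≈g (≈-refl {h})

⊕-congˡ : ∀ f {g h} → g ≈ h → f ⊕ g ≈ f ⊕ h
⊕-congˡ f = ⊕-cong {f} ≈-refl

•-cong : ∀ a {f g} → f ≈ g → a • f ≈ a • g
•-cong a f≈g n = cong (a *_) (f≈g n)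

X⊛-cong : ∀ {f g} → f ≈ g → X⊛ f ≈ X⊛ g
X⊛-cong f≈g zero    = refl
X⊛-cong f≈g (suc n) = f≈g n

⊛-comm : ∀ f g → f ⊛ g ≈ g ⊛ f
⊛-comm f g n = trans (sumTo-reverse n (λ i → f i * g (n ∸ i)))
  (sumTo-cong n (λ i i≤n → trans (cong (λ k → f (n ∸ i) * g k) (ℕₚ.m∸[m∸n]≡n i≤n)) (ℚₚ.*-comm (f (n ∸ i)) (g i))))

⊛-assoc : ∀ f g h → (f ⊛ g) ⊛ h ≈ f ⊛ (g ⊛ h)
⊛-assoc f g h n = begin
  sumTo n (λ i → sumTo i (λ j → f j * g (i ∸ j)) * h (n ∸ i))
    ≡⟨ sumTo-cong n (λ i _ → *-distribʳ-sumTo i (h (n ∸ i)) (λ j → f j * g (i ∸ j))) ⟩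
  sumTo n (λ i → sumTo i (λ j → f j * g (i ∸ j) * h (n ∸ i)))
    ≡⟨ sumTo-triangle n (λ j i → f j * g (i ∸ j) * h (n ∸ i)) ⟩
  sumTo n (λ j → sumTo (n ∸ j) (λ l → f j * g (j ℕ.+ l ∸ j) * h (n ∸ (j ℕ.+ l))))
    ≡⟨ sumTo-cong n (λ j _ → sumTo-cong (n ∸ j) (λ l _ → reindex j l)) ⟩
  sumTo n (λ j → sumTo (n ∸ j) (λ l → f j * (g l * h (n ∸ j ∸ l))))
    ≡⟨ sumTo-cong n (λ j _ → *-distribˡ-sumTo (n ∸ j) (f j) (λ l → g l * h (n ∸ j ∸ l))) ⟨
  sumTo n (λ j → f j * sumTo (n ∸ j) (λ l → g l * h (n ∸ j ∸ l)))
    ∎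
  where
  open ≡-Reasoning
  reindex : ∀ j l → f j * g (j ℕ.+ l ∸ j) * h (n ∸ (j ℕ.+ l)) ≡ f j * (g l * h (n ∸ j ∸ l))
  reindex j l = trans (cong₂ (λ a b → f j * g a * h b) (ℕₚ.m+n∸m≡n j l) (sym (ℕₚ.∸-+-assoc n j l)))
                      (ℚₚ.*-assoc (f j) (g l) (h (n ∸ j ∸ l)))

⊛-distribˡ-⊕ : ∀ f g h → f ⊛ (g ⊕ h) ≈ f ⊛ g ⊕ f ⊛ h
⊛-distribˡ-⊕ f g h n = trans (sumTo-cong n (λ i _ → ℚₚ.*-distribˡ-+ (f i) (g (n ∸ i)) (h (n ∸ i))))
                             (sumTo-distrib-+ n _ _)

⊛-distribʳ-⊕ : ∀ f g h → (g ⊕ h) ⊛ f ≈ g ⊛ f ⊕ h ⊛ f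
⊛-distribʳ-⊕ f g h = ≈-trans (⊛-comm (g ⊕ h) f)
  (≈-trans (⊛-distribˡ-⊕ f g h) (⊕-cong (⊛-comm f g) (⊛-comm f h)))

⊛-identityˡ : ∀ f → oneS ⊛ f ≈ f
⊛-identityˡ f zero    = ℚₚ.*-identityˡ (f 0)
⊛-identityˡ f (suc n) = begin
  sumTo (suc n) (λ i → oneS i * f (suc n ∸ i))        ≡⟨ sumTo-suc n _ ⟩
  1ℚ * f (suc n) + sumTo n (λ i → 0ℚ * f (n ∸ i))    ≡⟨ cong₂ _+_ (ℚₚ.*-identityˡ (f (suc n)))
                                                          (sumTo-zero n (λ i _ → ℚₚ.*-zeroˡ (f (n ∸ i)))) ⟩
  f (suc n) + 0ℚ                                      ≡⟨ ℚₚ.+-identityʳ (f (suc n)) ⟩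
  f (suc n)                                           ∎
  where open ≡-Reasoning

⊛-identityʳ : ∀ f → f ⊛ oneS ≈ f
⊛-identityʳ f = ≈-trans (⊛-comm f oneS) (⊛-identityˡ f)

⊛-zeroˡ : ∀ f → zeroS ⊛ f ≈ zeroS
⊛-zeroˡ f n = sumTo-zero n (λ i _ → ℚₚ.*-zeroˡ (f (n ∸ i)))

⊛-zeroʳ : ∀ f → f ⊛ zeroS ≈ zeroS
⊛-zeroʳ f = ≈-trans (⊛-comm f zeroS) (⊛-zeroˡ f)

series-isCommutativeSemiring : IsCommutativeSemiring _≈_ _⊕_ _⊛_ zeroS oneS
series-isCommutativeSemiring = record
  { isSemiring = record
    { isSemiringWithoutAnnihilatingZero = record
      { +-isCommutativeMonoid = record
        { isMonoid = record
          { isSemigroup = record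
            { isMagma = record { isEquivalence = ≈-isEquivalence ; ∙-cong = ⊕-cong }
            ; assoc   = λ f g h n → ℚₚ.+-assoc (f n) (g n) (h n)
            }
          ; identity = (λ f n → ℚₚ.+-identityˡ (f n)) , (λ f n → ℚₚ.+-identityʳ (f n))
          }
        ; comm = λ f g n → ℚₚ.+-comm (f n) (g n)
        }
      ; *-cong     = ⊛-cong
      ; *-assoc    = ⊛-assoc
      ; *-identity = ⊛-identityˡ , ⊛-identityʳ
      ; distrib    = ⊛-distribˡ-⊕ , ⊛-distribʳ-⊕
      }
    ; zero = ⊛-zeroˡ , ⊛-zeroʳ
    }
  ; *-comm = ⊛-comm
  }

series : CommutativeSemiring 0ℓ 0ℓ
series = record { isCommutativeSemiring = series-isCommutativeSemiring }

•-⊛ : ∀ a f g → (a • f) ⊛ g ≈ a • (f ⊛ g)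
•-⊛ a f g n = trans (sumTo-cong n (λ i _ → ℚₚ.*-assoc a (f i) (g (n ∸ i)))) (sym (*-distribˡ-sumTo n a _))

⊛-• : ∀ a f g → f ⊛ (a • g) ≈ a • (f ⊛ g)
⊛-• a f g = ≈-trans (⊛-comm f (a • g)) (≈-trans (•-⊛ a g f) (•-cong a (⊛-comm g f)))

•-distribˡ-⊕ : ∀ a f g → a • (f ⊕ g) ≈ a • f ⊕ a • g
•-distribˡ-⊕ a f g n = ℚₚ.*-distribˡ-+ a (f n) (g n)

•-distribʳ-+ : ∀ a b f → (a + b) • f ≈ a • f ⊕ b • f
•-distribʳ-+ a b f n = ℚₚ.*-distribʳ-+ (f n) a b

•-zeroʳ : ∀ a → a • zeroS ≈ zeroS
•-zeroʳ a n = ℚₚ.*-zeroʳ a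

X⊛-⊛ : ∀ f g → (X⊛ f) ⊛ g ≈ X⊛ (f ⊛ g)
X⊛-⊛ f g zero    = ℚₚ.*-zeroˡ (g 0)
X⊛-⊛ f g (suc n) = trans (sumTo-suc n (λ i → (X⊛ f) i * g (suc n ∸ i)))
  (trans (cong (_+ (f ⊛ g) n) (ℚₚ.*-zeroˡ (g (suc n)))) (ℚₚ.+-identityˡ ((f ⊛ g) n)))

⊛-X⊛ : ∀ f g → f ⊛ (X⊛ g) ≈ X⊛ (f ⊛ g)
⊛-X⊛ f g = ≈-trans (⊛-comm f (X⊛ g)) (≈-trans (X⊛-⊛ g f) (X⊛-cong (⊛-comm g f)))

powS-cong : ∀ {f g} k → f ≈ g → powS f k ≈ powS g k
powS-cong zero    f≈g = ≈-refl
powS-cong (suc k) f≈g = ⊛-cong f≈g (powS-cong k f≈g)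

powS-• : ∀ a f k → powS (a • f) k ≈ (a ^ k) • powS f k
powS-• a f zero    n = sym (ℚₚ.*-identityˡ (oneS n))
powS-• a f (suc k) = begin
  (a • f) ⊛ powS (a • f) k        ≈⟨ ⊛-congˡ (a • f) (powS-• a f k) ⟩
  (a • f) ⊛ ((a ^ k) • powS f k)  ≈⟨ •-⊛ a f ((a ^ k) • powS f k) ⟩
  a • (f ⊛ ((a ^ k) • powS f k))  ≈⟨ •-cong a (⊛-• (a ^ k) f (powS f k)) ⟩
  a • ((a ^ k) • powS f (suc k))  ≈⟨ (λ n → sym (ℚₚ.*-assoc a (a ^ k) (powS f (suc k) n))) ⟩
  (a ^ suc k) • powS f (suc k)    ∎
  where open ≈-Reasoning ≈-setoid

module 𝒮 where
  open CommutativeSemiring series public using (semiring)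
  open import Algebra.Properties.Semiring.Exp semiring public using (_^_)
  open import Algebra.Properties.Semiring.Mult semiring public using (_×_)
  open import Algebra.Properties.Semiring.Sum semiring public using (sum)
  open import Algebra.Properties.CommutativeSemiring.Binomial series public using (theorem)

powS≈^ : ∀ f n → powS f n ≈ f 𝒮.^ n
powS≈^ f zero    = ≈-refl
powS≈^ f (suc n) = ⊛-congˡ f (powS≈^ f n)

×≈• : ∀ n f → n 𝒮.× f ≈ toℚ n • f
×≈• zero    f j = sym (ℚₚ.*-zeroˡ (f j))
×≈• (suc n) f j = trans (cong (f j +_) (×≈• n f j)) (sym (toℚ-suc-* n (f j)))

sum-coeff : ∀ n (G : ℕ → Series) j → 𝒮.sum {suc n} (λ k → G (toℕ k)) j ≡ sumTo n (λ k → G k j)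
sum-coeff zero    G j = ℚₚ.+-identityʳ (G 0 j)
sum-coeff (suc n) G j = trans (cong (G 0 j +_) (sum-coeff n (λ k → G (suc k)) j)) (sym (sumTo-suc n (λ k → G k j)))

powS-⊕-binomial : ∀ N f g j →
  powS (f ⊕ g) N j ≡ sumTo N (λ k → toℚ (N C k) * (powS f k ⊛ powS g (N ∸ k)) j)
powS-⊕-binomial N f g j = begin
  powS (f ⊕ g) N j
    ≡⟨ powS≈^ (f ⊕ g) N j ⟩
  ((f ⊕ g) 𝒮.^ N) j
    ≡⟨ 𝒮.theorem N f g j ⟩
  𝒮.sum {suc N} (λ k → term (toℕ k)) j
    ≡⟨ sum-coeff N term j ⟩
  sumTo N (λ k → term k j)
    ≡⟨ sumTo-cong N (λ k _ → trans (×≈• (N C k) _ j) (cong (toℚ (N C k) *_)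
                                     (⊛-cong (≈-sym (powS≈^ f k)) (≈-sym (powS≈^ g (N ∸ k))) j))) ⟩
  sumTo N (λ k → toℚ (N C k) * (powS f k ⊛ powS g (N ∸ k)) j)
    ∎
  where
  open ≡-Reasoning
  term : ℕ → Series
  term k = (N C k) 𝒮.× ((f 𝒮.^ k) ⊛ (g 𝒮.^ (N ∸ k)))

-- The Euler operator

θ : Series → Series
θ f n = toℚ n * f n

θ-cong : ∀ {f g} → f ≈ g → θ f ≈ θ g
θ-cong f≈g n = cong (toℚ n *_) (f≈g n)

θ-oneS : θ oneS ≈ zeroS
θ-oneS zero    = ℚₚ.*-zeroˡ 1ℚ
θ-oneS (suc n) = ℚₚ.*-zeroʳ (toℚ (suc n))

θ-⊕ : ∀ f g → θ (f ⊕ g) ≈ θ f ⊕ θ g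
θ-⊕ f g n = ℚₚ.*-distribˡ-+ (toℚ n) (f n) (g n)

θ-⊛ : ∀ f g → θ (f ⊛ g) ≈ θ f ⊛ g ⊕ f ⊛ θ g
θ-⊛ f g n = begin
  toℚ n * sumTo n (λ i → f i * g (n ∸ i))
    ≡⟨ *-distribˡ-sumTo n (toℚ n) _ ⟩
  sumTo n (λ i → toℚ n * (f i * g (n ∸ i)))
    ≡⟨ sumTo-cong n (λ i i≤n → trans (cong (λ k → k * (f i * g (n ∸ i))) (split-weight i i≤n))
                                     (leibniz (toℚ i) (toℚ (n ∸ i)) (f i) (g (n ∸ i)))) ⟩
  sumTo n (λ i → (toℚ i * f i) * g (n ∸ i) + f i * (toℚ (n ∸ i) * g (n ∸ i)))
    ≡⟨ sumTo-distrib-+ n _ _ ⟩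
  (θ f ⊛ g ⊕ f ⊛ θ g) n
    ∎
  where
  open ≡-Reasoning
  split-weight : ∀ i → i ≤ n → toℚ n ≡ toℚ i + toℚ (n ∸ i)
  split-weight i i≤n = trans (cong toℚ (sym (ℕₚ.m+[n∸m]≡n i≤n))) (toℚ-homo-+ i (n ∸ i))
  leibniz : ∀ p k a b → (p + k) * (a * b) ≡ (p * a) * b + a * (k * b)
  leibniz = solve 4 (λ p k a b → (p :+ k) :* (a :* b) := (p :* a) :* b :+ a :* (k :* b)) refl
    where open +-*-Solver

θ-X⊛ : ∀ f → θ (X⊛ f) ≈ X⊛ (f ⊕ θ f)
θ-X⊛ f zero    = ℚₚ.*-zeroˡ 0ℚ
θ-X⊛ f (suc n) = toℚ-suc-* n (f n)

θ-powS : ∀ f k → θ (powS f (suc k)) ≈ toℚ (suc k) • (powS f k ⊛ θ f)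
θ-powS f zero = begin
  θ (f ⊛ oneS)            ≈⟨ θ-cong (⊛-identityʳ f) ⟩
  θ f                     ≈⟨ ⊛-identityˡ (θ f) ⟨
  oneS ⊛ θ f              ≈⟨ (λ n → sym (ℚₚ.*-identityˡ ((oneS ⊛ θ f) n))) ⟩
  1ℚ • (oneS ⊛ θ f)       ∎
  where open ≈-Reasoning ≈-setoid
θ-powS f (suc k) = begin
  θ (f ⊛ P)                              ≈⟨ θ-⊛ f P ⟩
  θ f ⊛ P ⊕ f ⊛ θ P                      ≈⟨ ⊕-cong (⊛-comm (θ f) P) (⊛-congˡ f (θ-powS f k)) ⟩
  P ⊛ θ f ⊕ f ⊛ (m • (powS f k ⊛ θ f))   ≈⟨ ⊕-congˡ (P ⊛ θ f) (≈-trans (⊛-• m f (powS f k ⊛ θ f))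
                                                                        (•-cong m (≈-sym (⊛-assoc f (powS f k) (θ f))))) ⟩
  P ⊛ θ f ⊕ m • (P ⊛ θ f)                ≈⟨ (λ n → toℚ-suc-* (suc k) ((P ⊛ θ f) n)) ⟨
  toℚ (suc (suc k)) • (P ⊛ θ f)          ∎
  where
  open ≈-Reasoning ≈-setoid
  P : Series
  P = powS f (suc k)
  m : ℚ
  m = toℚ (suc k)

θ-injective : ∀ {f g} → θ f ≈ θ g → f 0 ≡ g 0 → f ≈ g
θ-injective θf≈θg f₀≡g₀ zero    = f₀≡g₀
θ-injective θf≈θg f₀≡g₀ (suc n) = toℚ-*-cancelˡ (suc n) (θf≈θg (suc n))

-- Uniqueness of solutions of f′ = a f.
θ≈•X⊛-unique : ∀ a {f g} → θ f ≈ a • X⊛ f → θ g ≈ a • X⊛ g → f 0 ≡ g 0 → f ≈ g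
θ≈•X⊛-unique a θf θg f₀≡g₀ zero    = f₀≡g₀
θ≈•X⊛-unique a θf θg f₀≡g₀ (suc n) = toℚ-*-cancelˡ (suc n)
  (trans (θf (suc n)) (trans (cong (a *_) (θ≈•X⊛-unique a θf θg f₀≡g₀ n)) (sym (θg (suc n)))))

θ-powS-reciprocal : ∀ g h → g ⊛ h ≈ oneS → ∀ k →
  θ (powS h (suc k)) ⊕ toℚ (suc k) • (θ g ⊛ powS h (suc (suc k))) ≈ zeroS
θ-powS-reciprocal g h g⊛h≈1 k = begin
  θ (powS h (suc k)) ⊕ m • W                     ≈⟨ ⊕-cong (θ-powS h k) (≈-refl {m • W}) ⟩
  m • (powS h k ⊛ θ h) ⊕ m • W                   ≈⟨ •-distribˡ-⊕ m (powS h k ⊛ θ h) W ⟨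
  m • (powS h k ⊛ θ h ⊕ W)                       ≈⟨ •-cong m rearrange ⟩
  m • (powS h (suc k) ⊛ θ (g ⊛ h))               ≈⟨ •-cong m (⊛-congˡ (powS h (suc k)) (≈-trans (θ-cong g⊛h≈1) θ-oneS)) ⟩
  m • (powS h (suc k) ⊛ zeroS)                   ≈⟨ •-cong m (⊛-zeroʳ (powS h (suc k))) ⟩
  m • zeroS                                      ≈⟨ •-zeroʳ m ⟩
  zeroS                                          ∎
  where
  open ≈-Reasoning ≈-setoid
  open NaturalCoefficients series using (solve; _:=_; _:+_; _:*_)
  m : ℚ
  m = toℚ (suc k)
  W : Series
  W = θ g ⊛ powS h (suc (suc k))
  rearrange : powS h k ⊛ θ h ⊕ W ≈ powS h (suc k) ⊛ θ (g ⊛ h)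
  rearrange = begin
    powS h k ⊛ θ h ⊕ W                                  ≈⟨ ⊕-cong (⊛-congʳ (θ h) (≈-trans (≈-sym (⊛-identityˡ (powS h k)))
                                                                     (⊛-congʳ (powS h k) (≈-sym g⊛h≈1)))) (≈-refl {W}) ⟩
    ((g ⊛ h) ⊛ powS h k) ⊛ θ h ⊕ θ g ⊛ (h ⊛ (h ⊛ powS h k))
                                                        ≈⟨ solve 5 (λ g h p t d → ((g :* h) :* p) :* t :+ d :* (h :* (h :* p))
                                                                 := (h :* p) :* (d :* h :+ g :* t)) (λ _ → refl) g h (powS h k) (θ h) (θ g) ⟩
    powS h (suc k) ⊛ (θ g ⊛ h ⊕ g ⊛ θ h)               ≈⟨ ⊛-congˡ (powS h (suc k)) (≈-sym (θ-⊛ g h)) ⟩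
    powS h (suc k) ⊛ θ (g ⊛ h)                          ∎

-- g ⊕ θ g is the derivative of x g and h = 1 / g, so this coefficient is the residue of
-- (x g)′ / (x g)^(k+2), which is itself a derivative.
residue-derivative-zero : ∀ g h → g ⊛ h ≈ oneS → ∀ k → ((g ⊕ θ g) ⊛ powS h (suc (suc k))) (suc k) ≡ 0ℚ
residue-derivative-zero g h g⊛h≈1 k = toℚ-*-cancelˡ (suc k) (begin
  toℚ (suc k) * ((g ⊕ θ g) ⊛ H) (suc k)              ≡⟨ cong (toℚ (suc k) *_) (split (suc k)) ⟩
  toℚ (suc k) * (P (suc k) + W (suc k))              ≡⟨ ℚₚ.*-distribˡ-+ (toℚ (suc k)) (P (suc k)) (W (suc k)) ⟩
  θ P (suc k) + toℚ (suc k) * W (suc k)              ≡⟨ θ-powS-reciprocal g h g⊛h≈1 k (suc k) ⟩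
  0ℚ                                                 ≡⟨ ℚₚ.*-zeroʳ (toℚ (suc k)) ⟨
  toℚ (suc k) * 0ℚ                                   ∎)
  where
  open ≡-Reasoning
  P H W : Series
  P = powS h (suc k)
  H = powS h (suc (suc k))
  W = θ g ⊛ H
  split : (g ⊕ θ g) ⊛ H ≈ P ⊕ W
  split = ≈-trans (⊛-distribʳ-⊕ H g (θ g))
    (⊕-cong (≈-trans (≈-sym (⊛-assoc g h P)) (≈-trans (⊛-congʳ P g⊛h≈1) (⊛-identityˡ P))) (≈-refl {W}))

-- Reciprocals

-- Defs keeps the dot product behind invList private; unification recovers it from the unfolding of invS a (suc n).
mutual
  invS-dot : Series → ℕ → List ℚ → ℚ
  invS-dot a = _

  invS-suc : ∀ a n → invS a (suc n) ≡ - invS-dot a 0 (invList a n)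
  invS-suc a n with invList a n | 0
  ... | bs | j = refl

invS-dot-invList : ∀ a n j →
  invS-dot a j (invList a n) ≡ sumTo n (λ i → a (suc (j ℕ.+ i)) * invS a (n ∸ i))
invS-dot-invList a zero    j = trans (ℚₚ.+-identityʳ (a (suc j) * 1ℚ)) (cong (λ k → a (suc k) * 1ℚ) (sym (ℕₚ.+-identityʳ j)))
invS-dot-invList a (suc n) j = begin
  a (suc j) * invS a (suc n) + invS-dot a (suc j) (invList a n)
    ≡⟨ cong₂ _+_ (cong (λ k → a (suc k) * invS a (suc n)) (sym (ℕₚ.+-identityʳ j))) (invS-dot-invList a n (suc j)) ⟩
  a (suc (j ℕ.+ 0)) * invS a (suc n) + sumTo n (λ i → a (suc (suc j ℕ.+ i)) * invS a (n ∸ i))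
    ≡⟨ cong (a (suc (j ℕ.+ 0)) * invS a (suc n) +_)
            (sumTo-cong n (λ i _ → cong (λ k → a (suc k) * invS a (n ∸ i)) (sym (ℕₚ.+-suc j i)))) ⟩
  a (suc (j ℕ.+ 0)) * invS a (suc n) + sumTo n (λ i → a (suc (j ℕ.+ suc i)) * invS a (n ∸ i))
    ≡⟨ sumTo-suc n (λ i → a (suc (j ℕ.+ i)) * invS a (suc n ∸ i)) ⟨
  sumTo (suc n) (λ i → a (suc (j ℕ.+ i)) * invS a (suc n ∸ i))
    ∎
  where open ≡-Reasoning

⊛-invS : ∀ a → a 0 ≡ 1ℚ → a ⊛ invS a ≈ oneS
⊛-invS a a₀≡1 zero    = cong (_* 1ℚ) a₀≡1
⊛-invS a a₀≡1 (suc n) = begin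
  sumTo (suc n) (λ i → a i * invS a (suc n ∸ i))
    ≡⟨ sumTo-suc n _ ⟩
  a 0 * invS a (suc n) + sumTo n (λ i → a (suc i) * invS a (n ∸ i))
    ≡⟨ cong₂ _+_ (trans (cong (_* invS a (suc n)) a₀≡1) (ℚₚ.*-identityˡ (invS a (suc n)))) (sym (invS-dot-invList a n 0)) ⟩
  - invS-dot a 0 (invList a n) + invS-dot a 0 (invList a n)
    ≡⟨ ℚₚ.+-inverseˡ (invS-dot a 0 (invList a n)) ⟩
  0ℚ
    ∎
  where open ≡-Reasoning

-- Exponential and hyperbolic series

expS : ℚ → Series
expS a j = a ^ j * invFact j

θ-expS : ∀ a → θ (expS a) ≈ a • X⊛ expS a
θ-expS a zero    = trans (ℚₚ.*-zeroˡ (expS a 0)) (sym (ℚₚ.*-zeroʳ a))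
θ-expS a (suc n) = begin
  toℚ (suc n) * ((a * a ^ n) * invFact (suc n))  ≡⟨ solve 4 (λ i a p f → i :* ((a :* p) :* f) := a :* (p :* (i :* f))) refl
                                                          (toℚ (suc n)) a (a ^ n) (invFact (suc n)) ⟩
  a * (a ^ n * (toℚ (suc n) * invFact (suc n)))  ≡⟨ cong (λ z → a * (a ^ n * z)) (toℚ-suc-*-invFact-suc n) ⟩
  a * (a ^ n * invFact n)                        ∎
  where
  open ≡-Reasoning
  open +-*-Solver

expS-⊛ : ∀ a b → expS a ⊛ expS b ≈ expS (a + b)
expS-⊛ a b = θ≈•X⊛-unique (a + b) θ[eᵃ⊛eᵇ] (θ-expS (a + b)) refl
  where
  open ≈-Reasoning ≈-setoid
  θ[eᵃ⊛eᵇ] : θ (expS a ⊛ expS b) ≈ (a + b) • X⊛ (expS a ⊛ expS b)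
  θ[eᵃ⊛eᵇ] = begin
    θ (expS a ⊛ expS b)
      ≈⟨ θ-⊛ (expS a) (expS b) ⟩
    θ (expS a) ⊛ expS b ⊕ expS a ⊛ θ (expS b)
      ≈⟨ ⊕-cong (⊛-congʳ (expS b) (θ-expS a)) (⊛-congˡ (expS a) (θ-expS b)) ⟩
    (a • X⊛ expS a) ⊛ expS b ⊕ expS a ⊛ (b • X⊛ expS b)
      ≈⟨ ⊕-cong (≈-trans (•-⊛ a (X⊛ expS a) (expS b)) (•-cong a (X⊛-⊛ (expS a) (expS b))))
                (≈-trans (⊛-• b (expS a) (X⊛ expS b)) (•-cong b (⊛-X⊛ (expS a) (expS b)))) ⟩
    a • X⊛ (expS a ⊛ expS b) ⊕ b • X⊛ (expS a ⊛ expS b)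
      ≈⟨ •-distribʳ-+ a b _ ⟨
    (a + b) • X⊛ (expS a ⊛ expS b)
      ∎

expS-0 : expS 0ℚ ≈ oneS
expS-0 zero    = refl
expS-0 (suc j) = trans (cong (_* invFact (suc j)) (ℚₚ.*-zeroˡ (0ℚ ^ j))) (ℚₚ.*-zeroˡ (invFact (suc j)))

powS-expS : ∀ a k → powS (expS a) k ≈ expS (toℚ k * a)
powS-expS a zero    = ≈-sym (≈-trans (λ j → cong (λ b → expS b j) (ℚₚ.*-zeroˡ a)) expS-0)
powS-expS a (suc k) = begin
  expS a ⊛ powS (expS a) k        ≈⟨ ⊛-congˡ (expS a) (powS-expS a k) ⟩
  expS a ⊛ expS (toℚ k * a)       ≈⟨ expS-⊛ a (toℚ k * a) ⟩
  expS (a + toℚ k * a)            ≈⟨ (λ j → cong (λ b → expS b j) (toℚ-suc-* k a)) ⟨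
  expS (toℚ (suc k) * a)          ∎
  where
  open ≈-Reasoning ≈-setoid

expS-binomial : ∀ a b N j →
  powS (expS a ⊕ expS b) N j ≡ sumTo N (λ k → toℚ (N C k) * expS (toℚ k * a + toℚ (N ∸ k) * b) j)
expS-binomial a b N j = trans (powS-⊕-binomial N (expS a) (expS b) j) (sumTo-cong N (λ k _ → cong (toℚ (N C k) *_)
  (≈-trans (⊛-cong (powS-expS a k) (powS-expS b (N ∸ k))) (expS-⊛ (toℚ k * a) (toℚ (N ∸ k) * b)) j)))

cosh : Series
cosh j = if isEven j then invFact j else 0ℚ

isEven-2* : ∀ m → isEven (2 ℕ.* m) ≡ true
isEven-2* zero    = refl
isEven-2* (suc m) = trans (cong isEven (ℕₚ.*-suc 2 m)) (cong (λ b → not (not b)) (isEven-2* m))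

cosh-even : ∀ m → cosh (2 ℕ.* m) ≡ invFact (2 ℕ.* m)
cosh-even m rewrite isEven-2* m = refl

cosh-odd : ∀ m → cosh (suc (2 ℕ.* m)) ≡ 0ℚ
cosh-odd m rewrite isEven-2* m = refl

neg-^ : ∀ a j → (- a) ^ j ≡ (if isEven j then a ^ j else - (a ^ j))
neg-^ a zero = refl
neg-^ a (suc j) with isEven j | neg-^ a j
... | true  | eq = trans (cong (- a *_) eq) (sym (ℚₚ.neg-distribˡ-* a (a ^ j)))
... | false | eq = trans (cong (- a *_) eq) (solve 2 (λ a p → (:- a) :* (:- p) := a :* p) refl a (a ^ j))
  where open +-*-Solver

expS-+-expS-neg : ∀ a j → expS a j + expS (- a) j ≡ toℚ 2 * (a ^ j * cosh j)
expS-+-expS-neg a j rewrite neg-^ a j with isEven j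
... | true  = solve 2 (λ p f → p :* f :+ p :* f := con (toℚ 2) :* (p :* f)) refl (a ^ j) (invFact j)
  where open +-*-Solver
... | false = solve 2 (λ p f → p :* f :+ (:- p) :* f := con (toℚ 2) :* (p :* con 0ℚ)) refl (a ^ j) (invFact j)
  where open +-*-Solver

1^n≡1 : ∀ j → 1ℚ ^ j ≡ 1ℚ
1^n≡1 zero    = refl
1^n≡1 (suc j) = trans (ℚₚ.*-identityˡ (1ℚ ^ j)) (1^n≡1 j)

expS[-1]⊕expS[1]≈2•cosh : expS (- 1ℚ) ⊕ expS 1ℚ ≈ toℚ 2 • cosh
expS[-1]⊕expS[1]≈2•cosh j = begin
  expS (- 1ℚ) j + expS 1ℚ j      ≡⟨ ℚₚ.+-comm (expS (- 1ℚ) j) (expS 1ℚ j) ⟩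
  expS 1ℚ j + expS (- 1ℚ) j      ≡⟨ expS-+-expS-neg 1ℚ j ⟩
  toℚ 2 * (1ℚ ^ j * cosh j)      ≡⟨ cong (λ p → toℚ 2 * (p * cosh j)) (1^n≡1 j) ⟩
  toℚ 2 * (1ℚ * cosh j)          ≡⟨ cong (toℚ 2 *_) (ℚₚ.*-identityˡ (cosh j)) ⟩
  toℚ 2 * cosh j                 ∎
  where open ≡-Reasoning

sinh : Series
sinh = X⊛ sinhOverX

sinhOverX⊛xOverSinhX : sinhOverX ⊛ xOverSinhX ≈ oneS
sinhOverX⊛xOverSinhX = ⊛-invS sinhOverX refl

sinh⊛xOverSinhX : sinh ⊛ xOverSinhX ≈ X⊛ oneS
sinh⊛xOverSinhX = ≈-trans (X⊛-⊛ sinhOverX xOverSinhX) (X⊛-cong sinhOverX⊛xOverSinhX)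

cosh≈sinhOverX⊕θsinhOverX : cosh ≈ sinhOverX ⊕ θ sinhOverX
cosh≈sinhOverX⊕θsinhOverX j with isEven j
... | true  = sym (trans (sym (toℚ-suc-* j (invFact (suc j)))) (toℚ-suc-*-invFact-suc j))
... | false = sym (trans (ℚₚ.+-identityˡ (toℚ j * 0ℚ)) (ℚₚ.*-zeroʳ (toℚ j)))

θ-cosh : θ cosh ≈ X⊛ sinh
θ-cosh zero          = refl
θ-cosh (suc zero)    = refl
θ-cosh (suc (suc i)) with isEven i
... | true  = toℚ-suc-*-invFact-suc (suc i)
... | false = ℚₚ.*-zeroʳ (toℚ (suc (suc i)))

θ-sinh : θ sinh ≈ X⊛ cosh
θ-sinh = ≈-trans (θ-X⊛ sinhOverX) (X⊛-cong (≈-sym cosh≈sinhOverX⊕θsinhOverX))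

cosh²≈1⊕sinh² : cosh ⊛ cosh ≈ oneS ⊕ sinh ⊛ sinh
cosh²≈1⊕sinh² = θ-injective θ[cosh²]≈θ[1⊕sinh²] refl
  where
  open ≈-Reasoning ≈-setoid
  θ[cosh²]≈θ[1⊕sinh²] : θ (cosh ⊛ cosh) ≈ θ (oneS ⊕ sinh ⊛ sinh)
  θ[cosh²]≈θ[1⊕sinh²] = begin
    θ (cosh ⊛ cosh)                            ≈⟨ θ-⊛ cosh cosh ⟩
    θ cosh ⊛ cosh ⊕ cosh ⊛ θ cosh              ≈⟨ ⊕-cong (⊛-congʳ cosh θ-cosh) (⊛-congˡ cosh θ-cosh) ⟩
    (X⊛ sinh) ⊛ cosh ⊕ cosh ⊛ (X⊛ sinh)        ≈⟨ ⊕-cong (X⊛-⊛ sinh cosh) (⊛-X⊛ cosh sinh) ⟩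
    X⊛ (sinh ⊛ cosh) ⊕ X⊛ (cosh ⊛ sinh)        ≈⟨ ⊕-cong (X⊛-cong (⊛-comm sinh cosh)) (X⊛-cong (⊛-comm cosh sinh)) ⟩
    X⊛ (cosh ⊛ sinh) ⊕ X⊛ (sinh ⊛ cosh)        ≈⟨ ⊕-cong (X⊛-⊛ cosh sinh) (⊛-X⊛ sinh cosh) ⟨
    (X⊛ cosh) ⊛ sinh ⊕ sinh ⊛ (X⊛ cosh)        ≈⟨ ⊕-cong (⊛-congʳ sinh θ-sinh) (⊛-congˡ sinh θ-sinh) ⟨
    θ sinh ⊛ sinh ⊕ sinh ⊛ θ sinh              ≈⟨ θ-⊛ sinh sinh ⟨
    θ (sinh ⊛ sinh)                            ≈⟨ (λ n → ℚₚ.+-identityˡ (θ (sinh ⊛ sinh) n)) ⟨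
    zeroS ⊕ θ (sinh ⊛ sinh)                    ≈⟨ ⊕-cong θ-oneS (≈-refl {θ (sinh ⊛ sinh)}) ⟨
    θ oneS ⊕ θ (sinh ⊛ sinh)                   ≈⟨ θ-⊕ oneS (sinh ⊛ sinh) ⟨
    θ (oneS ⊕ sinh ⊛ sinh)                     ∎

-- Coefficients of odd powers of cosh

-- By definition Ω q p = 4^-q · binomialMoment q (2 p).
binomialMoment : ℕ → ℕ → ℚ
binomialMoment q j = sumTo q (λ k → toℚ ((suc (2 ℕ.* q) C k) ℕ.* (suc (2 ℕ.* q) ∸ 2 ℕ.* k) ℕ.^ j))

m∸2n+n≡m∸n : ∀ N k → 2 ℕ.* k ≤ N → (N ∸ 2 ℕ.* k) ℕ.+ k ≡ N ∸ k
m∸2n+n≡m∸n N k 2k≤N = begin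
  (N ∸ 2 ℕ.* k) ℕ.+ k     ≡⟨ cong (λ m → (N ∸ m) ℕ.+ k) (2*m≡m+m k) ⟩
  (N ∸ (k ℕ.+ k)) ℕ.+ k   ≡⟨ cong (ℕ._+ k) (ℕₚ.∸-+-assoc N k k) ⟨
  (N ∸ k ∸ k) ℕ.+ k       ≡⟨ ℕₚ.m∸n+n≡m (ℕₚ.m+n≤o⇒m≤o∸n k (subst (ℕ._≤ N) (2*m≡m+m k) 2k≤N)) ⟩
  N ∸ k                   ∎
  where open ≡-Reasoning

expS-binomial-pair : ∀ q k j → k ≤ q → let N = suc (2 ℕ.* q) in
  toℚ (N C k) * expS (toℚ k * - 1ℚ + toℚ (N ∸ k) * 1ℚ) j
    + toℚ (N C (N ∸ k)) * expS (toℚ (N ∸ k) * - 1ℚ + toℚ (N ∸ (N ∸ k)) * 1ℚ) j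
  ≡ toℚ 2 * (toℚ ((N C k) ℕ.* (N ∸ 2 ℕ.* k) ℕ.^ j) * cosh j)
expS-binomial-pair q k j k≤q = begin
  toℚ (N C k) * expS (toℚ k * - 1ℚ + toℚ (N ∸ k) * 1ℚ) j
    + toℚ (N C (N ∸ k)) * expS (toℚ (N ∸ k) * - 1ℚ + toℚ (N ∸ (N ∸ k)) * 1ℚ) j
    ≡⟨ cong₂ (λ u v → toℚ (N C k) * expS u j + toℚ (N C (N ∸ k)) * expS v j) rate-k rate-N∸k ⟩
  toℚ (N C k) * expS a j + toℚ (N C (N ∸ k)) * expS (- a) j
    ≡⟨ cong (λ w → toℚ (N C k) * expS a j + toℚ w * expS (- a) j) (nCk≡nC[n∸k] k≤N) ⟨
  toℚ (N C k) * expS a j + toℚ (N C k) * expS (- a) j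
    ≡⟨ ℚₚ.*-distribˡ-+ (toℚ (N C k)) (expS a j) (expS (- a) j) ⟨
  toℚ (N C k) * (expS a j + expS (- a) j)
    ≡⟨ cong (toℚ (N C k) *_) (expS-+-expS-neg a j) ⟩
  toℚ (N C k) * (toℚ 2 * (a ^ j * cosh j))
    ≡⟨ solve 4 (λ c t p h → c :* (t :* (p :* h)) := t :* ((c :* p) :* h)) refl (toℚ (N C k)) (toℚ 2) (a ^ j) (cosh j) ⟩
  toℚ 2 * ((toℚ (N C k) * a ^ j) * cosh j)
    ≡⟨ cong (λ z → toℚ 2 * (z * cosh j)) (trans (cong (toℚ (N C k) *_) (sym (toℚ-homo-^ (N ∸ 2 ℕ.* k) j)))
                                                (sym (toℚ-homo-* (N C k) _))) ⟩
  toℚ 2 * (toℚ ((N C k) ℕ.* (N ∸ 2 ℕ.* k) ℕ.^ j) * cosh j)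
    ∎
  where
  open ≡-Reasoning
  open +-*-Solver
  N : ℕ
  N = suc (2 ℕ.* q)
  a : ℚ
  a = toℚ (N ∸ 2 ℕ.* k)
  k≤N : k ≤ N
  k≤N = ℕₚ.≤-trans k≤q (ℕₚ.≤-trans (ℕₚ.m≤m+n q (q ℕ.+ 0)) (ℕₚ.n≤1+n (2 ℕ.* q)))
  N∸k≡a+k : toℚ (N ∸ k) ≡ a + toℚ k
  N∸k≡a+k = trans (cong toℚ (sym (m∸2n+n≡m∸n N k (ℕₚ.≤-trans (ℕₚ.*-monoʳ-≤ 2 k≤q) (ℕₚ.n≤1+n (2 ℕ.* q))))))
                  (toℚ-homo-+ (N ∸ 2 ℕ.* k) k)
  rate-k : toℚ k * - 1ℚ + toℚ (N ∸ k) * 1ℚ ≡ a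
  rate-k = trans (cong (λ z → toℚ k * - 1ℚ + z * 1ℚ) N∸k≡a+k)
                 (solve 2 (λ i a → i :* :- con 1ℚ :+ (a :+ i) :* con 1ℚ := a) refl (toℚ k) a)
  rate-N∸k : toℚ (N ∸ k) * - 1ℚ + toℚ (N ∸ (N ∸ k)) * 1ℚ ≡ - a
  rate-N∸k = trans (cong₂ (λ z w → z * - 1ℚ + toℚ w * 1ℚ) N∸k≡a+k (ℕₚ.m∸[m∸n]≡n k≤N))
                   (solve 2 (λ i a → (a :+ i) :* :- con 1ℚ :+ i :* con 1ℚ := :- a) refl (toℚ k) a)

2^[1+2q]≡2*4^q : ∀ q → 2 ℕ.^ suc (2 ℕ.* q) ≡ 2 ℕ.* 4 ℕ.^ q
2^[1+2q]≡2*4^q q = cong (2 ℕ.*_) (sym (ℕₚ.^-*-assoc 2 2 q))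

4^q*powS-cosh : ∀ q j → toℚ (4 ℕ.^ q) * powS cosh (suc (2 ℕ.* q)) j ≡ binomialMoment q j * cosh j
4^q*powS-cosh q j = toℚ-*-cancelˡ 2 (begin
  toℚ 2 * (toℚ (4 ℕ.^ q) * powS cosh N j)
    ≡⟨ ℚₚ.*-assoc (toℚ 2) (toℚ (4 ℕ.^ q)) (powS cosh N j) ⟨
  (toℚ 2 * toℚ (4 ℕ.^ q)) * powS cosh N j
    ≡⟨ cong (_* powS cosh N j) (trans (sym (toℚ-homo-* 2 (4 ℕ.^ q)))
                                      (trans (cong toℚ (sym (2^[1+2q]≡2*4^q q))) (toℚ-homo-^ 2 N))) ⟩
  toℚ 2 ^ N * powS cosh N j
    ≡⟨ powS-• (toℚ 2) cosh N j ⟨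
  powS (toℚ 2 • cosh) N j
    ≡⟨ powS-cong N expS[-1]⊕expS[1]≈2•cosh j ⟨
  powS (expS (- 1ℚ) ⊕ expS 1ℚ) N j
    ≡⟨ expS-binomial (- 1ℚ) 1ℚ N j ⟩
  sumTo N (λ k → toℚ (N C k) * expS (toℚ k * - 1ℚ + toℚ (N ∸ k) * 1ℚ) j)
    ≡⟨ sumTo-mirror-pairs q _ ⟩
  sumTo q (λ k → toℚ (N C k) * expS (toℚ k * - 1ℚ + toℚ (N ∸ k) * 1ℚ) j
                   + toℚ (N C (N ∸ k)) * expS (toℚ (N ∸ k) * - 1ℚ + toℚ (N ∸ (N ∸ k)) * 1ℚ) j)
    ≡⟨ sumTo-cong q (λ k k≤q → expS-binomial-pair q k j k≤q) ⟩
  sumTo q (λ k → toℚ 2 * (moment k * cosh j))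
    ≡⟨ *-distribˡ-sumTo q (toℚ 2) (λ k → moment k * cosh j) ⟨
  toℚ 2 * sumTo q (λ k → moment k * cosh j)
    ≡⟨ cong (toℚ 2 *_) (*-distribʳ-sumTo q (cosh j) moment) ⟨
  toℚ 2 * (binomialMoment q j * cosh j)
    ∎)
  where
  open ≡-Reasoning
  N : ℕ
  N = suc (2 ℕ.* q)
  moment : ℕ → ℚ
  moment k = toℚ ((N C k) ℕ.* (N ∸ 2 ℕ.* k) ℕ.^ j)

powS-cosh-coeff : ∀ q j → powS cosh (suc (2 ℕ.* q)) j ≡ ((ℤ.+ 1 / 4 ℕ.^ q) {{ℕₚ.m^n≢0 4 q}} * binomialMoment q j) * cosh j
powS-cosh-coeff q j = begin
  powS cosh (suc (2 ℕ.* q)) j                           ≡⟨ 1/-*-toℚ-* (4 ℕ.^ q) (powS cosh (suc (2 ℕ.* q)) j) ⟨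
  1/4^q * (toℚ (4 ℕ.^ q) * powS cosh (suc (2 ℕ.* q)) j) ≡⟨ cong (1/4^q *_) (4^q*powS-cosh q j) ⟩
  1/4^q * (binomialMoment q j * cosh j)                 ≡⟨ ℚₚ.*-assoc 1/4^q (binomialMoment q j) (cosh j) ⟨
  (1/4^q * binomialMoment q j) * cosh j                 ∎
  where
  open ≡-Reasoning
  instance
    4^q≢0 : NonZero (4 ℕ.^ q)
    4^q≢0 = ℕₚ.m^n≢0 4 q
  1/4^q : ℚ
  1/4^q = ℤ.+ 1 / 4 ℕ.^ q

powS-cosh-even : ∀ q m → powS cosh (suc (2 ℕ.* q)) (2 ℕ.* m) ≡ Ω q m * invFact (2 ℕ.* m)
powS-cosh-even q m = trans (powS-cosh-coeff q (2 ℕ.* m)) (cong (Ω q m *_) (cosh-even m))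

powS-cosh-odd : ∀ q m → powS cosh (suc (2 ℕ.* q)) (suc (2 ℕ.* m)) ≡ 0ℚ
powS-cosh-odd q m = trans (powS-cosh-coeff q (suc (2 ℕ.* m))) (trans (cong (ω *_) (cosh-odd m)) (ℚₚ.*-zeroʳ ω))
  where
  ω : ℚ
  ω = (ℤ.+ 1 / 4 ℕ.^ q) {{ℕₚ.m^n≢0 4 q}} * binomialMoment q (suc (2 ℕ.* m))

-- Residues of odd powers of cosh

X⊛oneS-⊛ : ∀ f → (X⊛ oneS) ⊛ f ≈ X⊛ f
X⊛oneS-⊛ f = ≈-trans (X⊛-⊛ oneS f) (X⊛-cong (⊛-identityˡ f))

cosh²-⊛-xOverSinhX² : ∀ f u →
  (cosh ⊛ (cosh ⊛ f)) ⊛ (xOverSinhX ⊛ (xOverSinhX ⊛ u)) ≈ f ⊛ (xOverSinhX ⊛ (xOverSinhX ⊛ u)) ⊕ X⊛ X⊛ (f ⊛ u)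
cosh²-⊛-xOverSinhX² f u = begin
  (cosh ⊛ (cosh ⊛ f)) ⊛ W                       ≈⟨ solve 3 (λ c f w → (c :* (c :* f)) :* w := (c :* c) :* (f :* w))
                                                           (λ _ → refl) cosh f W ⟩
  (cosh ⊛ cosh) ⊛ (f ⊛ W)                       ≈⟨ ⊛-congʳ (f ⊛ W) cosh²≈1⊕sinh² ⟩
  (oneS ⊕ sinh ⊛ sinh) ⊛ (f ⊛ W)                ≈⟨ solve 4 (λ s f t u → (con 1 :+ s :* s) :* (f :* (t :* (t :* u)))
                                                                  := f :* (t :* (t :* u)) :+ (s :* t) :* ((s :* t) :* (f :* u)))
                                                           (λ _ → refl) sinh f T u ⟩
  f ⊛ W ⊕ (sinh ⊛ T) ⊛ ((sinh ⊛ T) ⊛ (f ⊛ u))   ≈⟨ ⊕-congˡ (f ⊛ W) (⊛-cong sinh⊛xOverSinhX (⊛-congʳ (f ⊛ u) sinh⊛xOverSinhX)) ⟩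
  f ⊛ W ⊕ (X⊛ oneS) ⊛ ((X⊛ oneS) ⊛ (f ⊛ u))     ≈⟨ ⊕-congˡ (f ⊛ W) (≈-trans (X⊛oneS-⊛ _) (X⊛-cong (X⊛oneS-⊛ (f ⊛ u)))) ⟩
  f ⊛ W ⊕ X⊛ X⊛ (f ⊛ u)                         ∎
  where
  open ≈-Reasoning ≈-setoid
  open NaturalCoefficients series using (solve; _:=_; _:+_; _:*_; con)
  T W : Series
  T = xOverSinhX
  W = T ⊛ (T ⊛ u)

-- residue a b is the residue at 0 of cosh^(a+1) / sinh^(b+1).
residue : ℕ → ℕ → ℚ
residue a b = (powS cosh (suc a) ⊛ powS xOverSinhX (suc b)) b

residue-0 : ∀ b → residue 0 (suc b) ≡ 0ℚ
residue-0 b = trans (⊛-congʳ (powS xOverSinhX (suc (suc b))) (≈-trans (⊛-identityʳ cosh) cosh≈sinhOverX⊕θsinhOverX) (suc b))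
                    (residue-derivative-zero sinhOverX xOverSinhX sinhOverX⊛xOverSinhX b)

residue-suc-suc : ∀ a b → residue (suc (suc a)) (suc (suc b)) ≡ residue a (suc (suc b)) + residue a b
residue-suc-suc a b = cosh²-⊛-xOverSinhX² (powS cosh (suc a)) (powS xOverSinhX (suc b)) (suc (suc b))

residue[2q,2n]≡0 : ∀ q n → q < n → residue (2 ℕ.* q) (2 ℕ.* n) ≡ 0ℚ
residue[2q,2n]≡0 zero    (suc n) _         = trans (cong (residue 0) (ℕₚ.*-suc 2 n)) (residue-0 (suc (2 ℕ.* n)))
residue[2q,2n]≡0 (suc q) (suc n) (s≤s q<n) = begin
  residue (2 ℕ.* suc q) (2 ℕ.* suc n)                                ≡⟨ cong₂ residue (ℕₚ.*-suc 2 q) (ℕₚ.*-suc 2 n) ⟩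
  residue (suc (suc (2 ℕ.* q))) (suc (suc (2 ℕ.* n)))                ≡⟨ residue-suc-suc (2 ℕ.* q) (2 ℕ.* n) ⟩
  residue (2 ℕ.* q) (suc (suc (2 ℕ.* n))) + residue (2 ℕ.* q) (2 ℕ.* n)
    ≡⟨ cong₂ _+_ (trans (cong (residue (2 ℕ.* q)) (sym (ℕₚ.*-suc 2 n))) (residue[2q,2n]≡0 q (suc n) (ℕₚ.m≤n⇒m≤1+n q<n)))
                 (residue[2q,2n]≡0 q n q<n) ⟩
  0ℚ + 0ℚ                                                            ≡⟨ ℚₚ.+-identityˡ 0ℚ ⟩
  0ℚ                                                                 ∎
  where open ≡-Reasoning

mainTheorem8 : (q n : ℕ) → q < n →
    sumTo n (λ m → (c (2 ℕ.* n ∸ 2 ℕ.* m) n * invFact (2 ℕ.* m)) * Ω q m) ≡ 0ℚ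
mainTheorem8 q n q<n = begin
  sumTo n (λ m → (U (2 ℕ.* n ∸ 2 ℕ.* m) * invFact (2 ℕ.* m)) * Ω q m)
    ≡⟨ sumTo-cong n (λ m _ → even-term m) ⟩
  sumTo n (λ m → powS cosh N (2 ℕ.* m) * U (2 ℕ.* n ∸ 2 ℕ.* m))
    ≡⟨ sumTo-even-indices n (λ i → powS cosh N i * U (2 ℕ.* n ∸ i)) odd-term ⟨
  residue (2 ℕ.* q) (2 ℕ.* n)
    ≡⟨ residue[2q,2n]≡0 q n q<n ⟩
  0ℚ
    ∎
  where
  open ≡-Reasoning
  open +-*-Solver
  N : ℕ
  N = suc (2 ℕ.* q)
  U : Series
  U = powS xOverSinhX (suc (2 ℕ.* n))
  even-term : ∀ m → (U (2 ℕ.* n ∸ 2 ℕ.* m) * invFact (2 ℕ.* m)) * Ω q m ≡ powS cosh N (2 ℕ.* m) * U (2 ℕ.* n ∸ 2 ℕ.* m)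
  even-term m = begin
    (u * invFact (2 ℕ.* m)) * Ω q m   ≡⟨ solve 3 (λ u f w → (u :* f) :* w := (w :* f) :* u) refl u (invFact (2 ℕ.* m)) (Ω q m) ⟩
    (Ω q m * invFact (2 ℕ.* m)) * u   ≡⟨ cong (_* u) (powS-cosh-even q m) ⟨
    powS cosh N (2 ℕ.* m) * u         ∎
    where
    u : ℚ
    u = U (2 ℕ.* n ∸ 2 ℕ.* m)
  odd-term : ∀ m → powS cosh N (suc (2 ℕ.* m)) * U (2 ℕ.* n ∸ suc (2 ℕ.* m)) ≡ 0ℚ
  odd-term m = trans (cong (_* U (2 ℕ.* n ∸ suc (2 ℕ.* m))) (powS-cosh-odd q m)) (ℚₚ.*-zeroˡ (U (2 ℕ.* n ∸ suc (2 ℕ.* m))))
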